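{- Let $A=\begin{pmatrix} a & b \\ c & 0 \end{pmatrix}\in M_2(\mathbb{Z})$ with $bc\neq 0$ and $\gcd(a,b,c)=1$. Then the ring $C(A)$ has no zero divisors if and only if $a^2+4bc$ is not the square of an integer.
   Context: $C(A)=\{B\in M_2(\mathbb{Z}): AB=BA\}$, considered as a ring under matrix addition and multiplication. -}

module Defs where

open import Data.Integer using (ℤ; _+_; _*_; 0ℤ)
open import Data.Integer.GCD using (gcd)
open import Data.Product using (Σ; ∃; _×_)
open import Relation.Binary.PropositionalEquality using (_≡_)
open import Relation.Nullary using (¬_)

record M2 : Set where
  constructor mat
  field
    m11 m12 m21 m22 : ℤ

open M2 public

_⊗_ : M2 → M2 → M2
mat a b c d ⊗ mat e f g h =
  mat (a * e + b * g) (a * f + b * h) (c * e + d * g) (c * f + d * h)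

𝟎 : M2
𝟎 = mat 0ℤ 0ℤ 0ℤ 0ℤ

-- membership in the centralizer C(A) = { B ∈ M₂(ℤ) : AB = BA }
InC : M2 → M2 → Set
InC A B = A ⊗ B ≡ B ⊗ A

NoZeroDivisors : M2 → Set
NoZeroDivisors A =
  ∀ (B D : M2) → InC A B → InC A D → ¬ (B ≡ 𝟎) → ¬ (D ≡ 𝟎) → ¬ (B ⊗ D ≡ 𝟎)

IsSquare : ℤ → Set
IsSquare n = ∃ λ (k : ℤ) → k * k ≡ n

gcd3 : ℤ → ℤ → ℤ → ℤ
gcd3 a b c = gcd (gcd a b) c

{-# OPTIONS --safe #-}

-- Write A = (a b; c d) with b ≠ 0, and Δ = (a − d)² + 4bc = tr² − 4 det for the
-- discriminant of its characteristic polynomial. If Δ = s², the polynomials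
-- 2A − (tr A ± s)I in A are nonzero, commute with A and multiply to (Δ − s²)I = 0.
-- Conversely, a zero divisor B = (x y; z w) of C(A) is singular (multiply by adj B),
-- and commuting with A means bz = cy and b(x − w) = (a − d)y, whence
-- (b(x + w))² = y²Δ + 4b² det B = y²Δ. If y ≠ 0 this makes Δ a rational, hence an
-- integer, square; if y = 0 it forces B = 0.
module Submission where

open import Defs
open import Data.Integer using (ℤ; _+_; _*_; 0ℤ; 1ℤ; +_)
open import Relation.Binary.PropositionalEquality using (_≡_)
open import Relation.Nullary using (¬_)
open import Function.Bundles using (_⇔_)

open import Data.Integer using (_-_; -_; +0; +[1+_]; -[1+_]; ∣_∣; _≟_)
open import Data.Integer.Properties
  using (i*j≡0⇒i≡0∨j≡0; *-zeroʳ; +-identityʳ;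
         i≡j⇒i-j≡0; i-j≡0⇒i≡j; pos-*; abs-*; ∣i∣≡0⇒i≡0)
open import Data.Integer.Tactic.RingSolver using (solve)
open import Data.Nat as ℕ using (NonZero; ≢-nonZero)
import Data.Nat.Properties as ℕ
import Data.Nat.Tactic.RingSolver as ℕ-Solver
open import Data.Nat.Coprimality using (Coprime; coprime-/gcd; coprime-divisor)
import Data.Nat.Coprimality as Coprime
open import Data.Nat.Divisibility using (_∣_; divides; ∣-refl)
open import Data.Nat.DivMod using (_/_; m/n*n≡m)
open import Data.Nat.GCD using (gcd; gcd[m,n]≢0; gcd[m,n]∣m; gcd[m,n]∣n)
open import Data.List using (_∷_; [])
open import Data.Product using (∃; _,_)
open import Data.Sum using (_⊎_; inj₁; inj₂; [_,_]′; reduce)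
open import Data.Empty using (⊥-elim)
open import Function using (id; _∘_; flip)
open import Function.Bundles using (mk⇔)
open import Relation.Binary.PropositionalEquality
  using (_≢_; refl; sym; trans; cong; cong₂; subst; subst₂; module ≡-Reasoning)
open import Relation.Nullary using (yes; no)

open ≡-Reasoning

coprime∧m*m≡k*k*n⇒k≡1 : ∀ {m k n} → Coprime m k → m ℕ.* m ≡ k ℕ.* k ℕ.* n → k ≡ 1
coprime∧m*m≡k*k*n⇒k≡1 {m} {k} {n} m⊥k eq = m⊥k (k∣m , ∣-refl)
  where
  k∣m : k ∣ m
  k∣m = coprime-divisor (Coprime.sym m⊥k)
          (divides (k ℕ.* n) (trans eq (ℕ-Solver.solve (k ∷ n ∷ []))))

*-cancelʳ-square : ∀ {m k n} g .{{_ : NonZero g}} →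
                   (m ℕ.* g) ℕ.* (m ℕ.* g) ≡ (k ℕ.* g) ℕ.* (k ℕ.* g) ℕ.* n →
                   m ℕ.* m ≡ k ℕ.* k ℕ.* n
*-cancelʳ-square {m} {k} {n} g eq = ℕ.*-cancelʳ-≡ _ _ (g ℕ.* g) {{ℕ.m*n≢0 g g}} (begin
  m ℕ.* m ℕ.* (g ℕ.* g)           ≡⟨ ℕ-Solver.solve (m ∷ g ∷ []) ⟩
  (m ℕ.* g) ℕ.* (m ℕ.* g)         ≡⟨ eq ⟩
  (k ℕ.* g) ℕ.* (k ℕ.* g) ℕ.* n   ≡⟨ ℕ-Solver.solve (k ∷ g ∷ n ∷ []) ⟩
  k ℕ.* k ℕ.* n ℕ.* (g ℕ.* g)     ∎)

m*m≡k*k*n⇒∃j*j≡n : ∀ {m k n} → k ≢ 0 → m ℕ.* m ≡ k ℕ.* k ℕ.* n → ∃ λ j → j ℕ.* j ≡ n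
m*m≡k*k*n⇒∃j*j≡n {m} {k} {n} k≢0 eq =
  m / g , (begin
    (m / g) ℕ.* (m / g)         ≡⟨ m′m′≡k′k′n ⟩
    (k / g) ℕ.* (k / g) ℕ.* n   ≡⟨ cong (λ u → u ℕ.* u ℕ.* n) k′≡1 ⟩
    1 ℕ.* n                     ≡⟨ ℕ.*-identityˡ n ⟩
    n                           ∎)
  where
  g = gcd m k
  instance
    g≢0 : NonZero g
    g≢0 = ≢-nonZero (gcd[m,n]≢0 m k (inj₂ k≢0))
  m′m′≡k′k′n : (m / g) ℕ.* (m / g) ≡ (k / g) ℕ.* (k / g) ℕ.* n
  m′m′≡k′k′n = *-cancelʳ-square {m / g} {k / g} g (subst₂ (λ u v → u ℕ.* u ≡ v ℕ.* v ℕ.* n)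
    (sym (m/n*n≡m (gcd[m,n]∣m m k))) (sym (m/n*n≡m (gcd[m,n]∣n m k))) eq)
  k′≡1 : k / g ≡ 1
  k′≡1 = coprime∧m*m≡k*k*n⇒k≡1 (coprime-/gcd m k) m′m′≡k′k′n

i*i≡+∣i∣*∣i∣ : ∀ i → i * i ≡ + (∣ i ∣ ℕ.* ∣ i ∣)
i*i≡+∣i∣*∣i∣ (+ n)    = sym (pos-* n n)
i*i≡+∣i∣*∣i∣ -[1+ n ] = refl

i*i≢k*k*-[1+n] : ∀ i k n → k ≢ 0ℤ → i * i ≢ k * k * -[1+ n ]
i*i≢k*k*-[1+n] i +0       n k≢0 _  = k≢0 refl
i*i≢k*k*-[1+n] i +[1+ k ] n _   eq with () ← trans (sym (i*i≡+∣i∣*∣i∣ i)) eq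
i*i≢k*k*-[1+n] i -[1+ k ] n _   eq with () ← trans (sym (i*i≡+∣i∣*∣i∣ i)) eq

i*i≡k*k*j⇒IsSquare : ∀ i k j → k ≢ 0ℤ → i * i ≡ k * k * j → IsSquare j
i*i≡k*k*j⇒IsSquare i k -[1+ n ] k≢0 eq = ⊥-elim (i*i≢k*k*-[1+n] i k n k≢0 eq)
i*i≡k*k*j⇒IsSquare i k (+ n)    k≢0 eq =
  +-square (m*m≡k*k*n⇒∃j*j≡n {∣ i ∣} {∣ k ∣} (k≢0 ∘ ∣i∣≡0⇒i≡0) ∣eq∣)
  where
  ∣eq∣ : ∣ i ∣ ℕ.* ∣ i ∣ ≡ ∣ k ∣ ℕ.* ∣ k ∣ ℕ.* n
  ∣eq∣ = begin
    ∣ i ∣ ℕ.* ∣ i ∣         ≡⟨ abs-* i i ⟨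
    ∣ i * i ∣               ≡⟨ cong ∣_∣ eq ⟩
    ∣ k * k * + n ∣         ≡⟨ abs-* (k * k) (+ n) ⟩
    ∣ k * k ∣ ℕ.* n         ≡⟨ cong (ℕ._* n) (abs-* k k) ⟩
    ∣ k ∣ ℕ.* ∣ k ∣ ℕ.* n   ∎
  +-square : (∃ λ m → m ℕ.* m ≡ n) → IsSquare (+ n)
  +-square (m , m*m≡n) = + m , trans (sym (pos-* m m)) (cong +_ m*m≡n)

infixr 25 _·_

_·_ : ℤ → M2 → M2
k · mat x y z w = mat (k * x) (k * y) (k * z) (k * w)

scalar : ℤ → M2
scalar k = mat k 0ℤ 0ℤ k

tr det : M2 → ℤ
tr (mat x _ _ w)  = x + w
det (mat x y z w) = x * w - y * z

adj : M2 → M2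
adj (mat x y z w) = mat w (- y) (- z) x

discriminant : M2 → ℤ
discriminant (mat a b c d) = (a - d) * (a - d) + + 4 * (b * c)

mat-cong : ∀ {x y z w x′ y′ z′ w′} → x ≡ x′ → y ≡ y′ → z ≡ z′ → w ≡ w′ →
           mat x y z w ≡ mat x′ y′ z′ w′
mat-cong refl refl refl refl = refl

i≢0∧i*j≡0⇒j≡0 : ∀ {i j} → i ≢ 0ℤ → i * j ≡ 0ℤ → j ≡ 0ℤ
i≢0∧i*j≡0⇒j≡0 i≢0 i*j≡0 = [ ⊥-elim ∘ i≢0 , id ]′ (i*j≡0⇒i≡0∨j≡0 _ i*j≡0)

k·D≡𝟎⇒k≡0∨D≡𝟎 : ∀ k D → k · D ≡ 𝟎 → k ≡ 0ℤ ⊎ D ≡ 𝟎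
k·D≡𝟎⇒k≡0∨D≡𝟎 k D k·D≡𝟎 with k ≟ 0ℤ
... | yes k≡0 = inj₁ k≡0
... | no  k≢0 = inj₂ (mat-cong (entry (cong m11 k·D≡𝟎)) (entry (cong m12 k·D≡𝟎))
                               (entry (cong m21 k·D≡𝟎)) (entry (cong m22 k·D≡𝟎)))
  where
  entry : ∀ {x} → k * x ≡ 0ℤ → x ≡ 0ℤ
  entry = i≢0∧i*j≡0⇒j≡0 k≢0

⊗-zeroʳ : ∀ B → B ⊗ 𝟎 ≡ 𝟎
⊗-zeroʳ (mat x y z w) = mat-cong (row x y) (row x y) (row z w) (row z w)
  where
  row : ∀ u v → u * 0ℤ + v * 0ℤ ≡ 0ℤ
  row u v = solve (u ∷ v ∷ [])

adj-⊗-⊗ : ∀ B D → adj B ⊗ (B ⊗ D) ≡ det B · D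
adj-⊗-⊗ (mat x y z w) (mat p q r t) =
  mat-cong (row₁ p r) (row₁ q t) (row₂ p r) (row₂ q t)
  where
  row₁ : ∀ p r → w * (x * p + y * r) + - y * (z * p + w * r) ≡ (x * w - y * z) * p
  row₁ p r = solve (x ∷ y ∷ z ∷ w ∷ p ∷ r ∷ [])
  row₂ : ∀ p r → - z * (x * p + y * r) + x * (z * p + w * r) ≡ (x * w - y * z) * r
  row₂ p r = solve (x ∷ y ∷ z ∷ w ∷ p ∷ r ∷ [])

⊗≡𝟎⇒det≡0 : ∀ B D → B ⊗ D ≡ 𝟎 → D ≢ 𝟎 → det B ≡ 0ℤ
⊗≡𝟎⇒det≡0 B D B⊗D≡𝟎 D≢𝟎 = [ id , ⊥-elim ∘ D≢𝟎 ]′ (k·D≡𝟎⇒k≡0∨D≡𝟎 (det B) D det[B]·D≡𝟎)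
  where
  det[B]·D≡𝟎 : det B · D ≡ 𝟎
  det[B]·D≡𝟎 = begin
    det B · D           ≡⟨ adj-⊗-⊗ B D ⟨
    adj B ⊗ (B ⊗ D)     ≡⟨ cong (adj B ⊗_) B⊗D≡𝟎 ⟩
    adj B ⊗ 𝟎           ≡⟨ ⊗-zeroʳ (adj B) ⟩
    𝟎                   ∎

InC⇒b*z≡c*y : ∀ A B → InC A B → m12 A * m21 B ≡ m21 A * m12 B
InC⇒b*z≡c*y (mat a b c d) (mat x y z w) AB≡BA = begin
  b * z                   ≡⟨ solve (a ∷ b ∷ x ∷ z ∷ []) ⟩
  a * x + b * z - x * a   ≡⟨ cong (_- x * a) (cong m11 AB≡BA) ⟩
  x * a + y * c - x * a   ≡⟨ solve (a ∷ c ∷ x ∷ y ∷ []) ⟩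
  c * y                   ∎

InC⇒b*[x-w]≡[a-d]*y : ∀ A B → InC A B → m12 A * (m11 B - m22 B) ≡ (m11 A - m22 A) * m12 B
InC⇒b*[x-w]≡[a-d]*y (mat a b c d) (mat x y z w) AB≡BA = begin
  b * (x - w)                     ≡⟨ solve (b ∷ d ∷ x ∷ y ∷ w ∷ []) ⟩
  x * b + y * d - b * w - d * y   ≡⟨ cong (λ u → u - b * w - d * y) (cong m12 AB≡BA) ⟨
  a * y + b * w - b * w - d * y   ≡⟨ solve (a ∷ b ∷ d ∷ y ∷ w ∷ []) ⟩
  (a - d) * y                     ∎

InC⇒[b*tr]²≡y*y*Δ+4*b*b*det : ∀ A B → InC A B →
  (m12 A * tr B) * (m12 A * tr B) ≡ m12 B * m12 B * discriminant A + + 4 * (m12 A * m12 A) * det B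
InC⇒[b*tr]²≡y*y*Δ+4*b*b*det A@(mat a b c d) B@(mat x y z w) AB≡BA = begin
  (b * (x + w)) * (b * (x + w))
    ≡⟨ solve (b ∷ x ∷ y ∷ z ∷ w ∷ []) ⟩
  (b * (x - w)) * (b * (x - w)) + + 4 * (b * y) * (b * z) + + 4 * (b * b) * (x * w - y * z)
    ≡⟨ cong₂ (λ u v → u * u + + 4 * (b * y) * v + + 4 * (b * b) * (x * w - y * z))
             (InC⇒b*[x-w]≡[a-d]*y A B AB≡BA) (InC⇒b*z≡c*y A B AB≡BA) ⟩
  ((a - d) * y) * ((a - d) * y) + + 4 * (b * y) * (c * y) + + 4 * (b * b) * (x * w - y * z)
    ≡⟨ solve (a ∷ b ∷ c ∷ d ∷ x ∷ y ∷ z ∷ w ∷ []) ⟩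
  y * y * ((a - d) * (a - d) + + 4 * (b * c)) + + 4 * (b * b) * (x * w - y * z)
    ∎

InC∧det≡0⇒[b*tr]²≡y*y*Δ : ∀ A B → InC A B → det B ≡ 0ℤ →
  (m12 A * tr B) * (m12 A * tr B) ≡ m12 B * m12 B * discriminant A
InC∧det≡0⇒[b*tr]²≡y*y*Δ A B AB≡BA det≡0 = begin
  (m12 A * tr B) * (m12 A * tr B)          ≡⟨ InC⇒[b*tr]²≡y*y*Δ+4*b*b*det A B AB≡BA ⟩
  y²Δ + + 4 * (m12 A * m12 A) * det B      ≡⟨ cong (λ t → y²Δ + + 4 * (m12 A * m12 A) * t) det≡0 ⟩
  y²Δ + + 4 * (m12 A * m12 A) * 0ℤ         ≡⟨ cong (_+_ y²Δ) (*-zeroʳ (+ 4 * (m12 A * m12 A))) ⟩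
  y²Δ + 0ℤ                                 ≡⟨ +-identityʳ y²Δ ⟩
  y²Δ                                      ∎
  where y²Δ = m12 B * m12 B * discriminant A

InC∧det≡0∧m12≡0⇒≡𝟎 : ∀ A B → m12 A ≢ 0ℤ → InC A B → det B ≡ 0ℤ → m12 B ≡ 0ℤ → B ≡ 𝟎
InC∧det≡0∧m12≡0⇒≡𝟎 A@(mat a b c d) B@(mat x y z w) b≢0 AB≡BA det≡0 refl =
  mat-cong x≡0 refl z≡0 (trans (sym x≡w) x≡0)
  where
  z≡0 : z ≡ 0ℤ
  z≡0 = i≢0∧i*j≡0⇒j≡0 b≢0 (trans (InC⇒b*z≡c*y A B AB≡BA) (*-zeroʳ c))
  x≡w : x ≡ w
  x≡w = i-j≡0⇒i≡j x w
          (i≢0∧i*j≡0⇒j≡0 b≢0 (trans (InC⇒b*[x-w]≡[a-d]*y A B AB≡BA) (*-zeroʳ (a - d))))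
  x≡0 : x ≡ 0ℤ
  x≡0 = reduce (i*j≡0⇒i≡0∨j≡0 x (begin
    x * x       ≡⟨ cong (x *_) x≡w ⟩
    x * w       ≡⟨ +-identityʳ (x * w) ⟨
    det B       ≡⟨ det≡0 ⟩
    0ℤ          ∎))

-- 2A − (tr A + s)I
doubledShift : M2 → ℤ → M2
doubledShift (mat a b c d) s = mat (a - d - s) (+ 2 * b) (+ 2 * c) (d - a - s)

doubledShift-commutes : ∀ A s → InC A (doubledShift A s)
doubledShift-commutes (mat a b c d) s = mat-cong e₁₁ e₁₂ e₂₁ e₂₂
  where
  e₁₁ : a * (a - d - s) + b * (+ 2 * c) ≡ (a - d - s) * a + (+ 2 * b) * c
  e₁₁ = solve (a ∷ b ∷ c ∷ d ∷ s ∷ [])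
  e₁₂ : a * (+ 2 * b) + b * (d - a - s) ≡ (a - d - s) * b + (+ 2 * b) * d
  e₁₂ = solve (a ∷ b ∷ c ∷ d ∷ s ∷ [])
  e₂₁ : c * (a - d - s) + d * (+ 2 * c) ≡ (+ 2 * c) * a + (d - a - s) * c
  e₂₁ = solve (a ∷ b ∷ c ∷ d ∷ s ∷ [])
  e₂₂ : c * (+ 2 * b) + d * (d - a - s) ≡ (+ 2 * c) * b + (d - a - s) * d
  e₂₂ = solve (a ∷ b ∷ c ∷ d ∷ s ∷ [])

doubledShift-⊗-doubledShift : ∀ A s →
  doubledShift A s ⊗ doubledShift A (- s) ≡ scalar (discriminant A - s * s)
doubledShift-⊗-doubledShift (mat a b c d) s = mat-cong e₁₁ e₁₂ e₂₁ e₂₂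
  where
  e₁₁ : (a - d - s) * (a - d - - s) + (+ 2 * b) * (+ 2 * c)
      ≡ (a - d) * (a - d) + + 4 * (b * c) - s * s
  e₁₁ = solve (a ∷ b ∷ c ∷ d ∷ s ∷ [])
  e₁₂ : (a - d - s) * (+ 2 * b) + (+ 2 * b) * (d - a - - s) ≡ 0ℤ
  e₁₂ = solve (a ∷ b ∷ d ∷ s ∷ [])
  e₂₁ : (+ 2 * c) * (a - d - - s) + (d - a - s) * (+ 2 * c) ≡ 0ℤ
  e₂₁ = solve (a ∷ c ∷ d ∷ s ∷ [])
  e₂₂ : (+ 2 * c) * (+ 2 * b) + (d - a - s) * (d - a - - s)
      ≡ (a - d) * (a - d) + + 4 * (b * c) - s * s
  e₂₂ = solve (a ∷ b ∷ c ∷ d ∷ s ∷ [])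

doubledShift≢𝟎 : ∀ A s → m12 A ≢ 0ℤ → doubledShift A s ≢ 𝟎
doubledShift≢𝟎 A s b≢0 S≡𝟎 = b≢0 (i≢0∧i*j≡0⇒j≡0 {+ 2} (λ ()) (cong m12 S≡𝟎))

IsSquare[Δ]⇒¬NoZeroDivisors : ∀ A → m12 A ≢ 0ℤ → IsSquare (discriminant A) → ¬ NoZeroDivisors A
IsSquare[Δ]⇒¬NoZeroDivisors A b≢0 (s , s*s≡Δ) noZeroDivisors =
  noZeroDivisors (doubledShift A s) (doubledShift A (- s))
    (doubledShift-commutes A s) (doubledShift-commutes A (- s))
    (doubledShift≢𝟎 A s b≢0) (doubledShift≢𝟎 A (- s) b≢0)
    (trans (doubledShift-⊗-doubledShift A s) (cong scalar (i≡j⇒i-j≡0 (sym s*s≡Δ))))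

¬IsSquare[Δ]⇒NoZeroDivisors : ∀ A → m12 A ≢ 0ℤ → ¬ IsSquare (discriminant A) → NoZeroDivisors A
¬IsSquare[Δ]⇒NoZeroDivisors A b≢0 ¬square B D AB≡BA _ B≢𝟎 D≢𝟎 B⊗D≡𝟎
  with det≡0 ← ⊗≡𝟎⇒det≡0 B D B⊗D≡𝟎 D≢𝟎 | m12 B ≟ 0ℤ
... | yes y≡0 = B≢𝟎 (InC∧det≡0∧m12≡0⇒≡𝟎 A B b≢0 AB≡BA det≡0 y≡0)
... | no  y≢0 = ¬square (i*i≡k*k*j⇒IsSquare (m12 A * tr B) (m12 B) (discriminant A) y≢0
                           (InC∧det≡0⇒[b*tr]²≡y*y*Δ A B AB≡BA det≡0))

NoZeroDivisors⇔¬IsSquare[Δ] : ∀ A → m12 A ≢ 0ℤ → NoZeroDivisors A ⇔ (¬ IsSquare (discriminant A))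
NoZeroDivisors⇔¬IsSquare[Δ] A b≢0 =
  mk⇔ (flip (IsSquare[Δ]⇒¬NoZeroDivisors A b≢0))
      (¬IsSquare[Δ]⇒NoZeroDivisors A b≢0)

proposition2p4 : (a b c : ℤ) → ¬ (b * c ≡ 0ℤ) → gcd3 a b c ≡ 1ℤ →
    NoZeroDivisors (mat a b c 0ℤ) ⇔ (¬ IsSquare (a * a + + 4 * (b * c)))
proposition2p4 a b c bc≢0 _ =
  subst (λ Δ → NoZeroDivisors (mat a b c 0ℤ) ⇔ (¬ IsSquare Δ)) Δ≡a*a+4*b*c
        (NoZeroDivisors⇔¬IsSquare[Δ] (mat a b c 0ℤ) b≢0)
  where
  b≢0 : b ≢ 0ℤ
  b≢0 b≡0 = bc≢0 (cong (_* c) b≡0)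
  Δ≡a*a+4*b*c : discriminant (mat a b c 0ℤ) ≡ a * a + + 4 * (b * c)
  Δ≡a*a+4*b*c = cong (λ u → u * u + + 4 * (b * c)) (+-identityʳ a)
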